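{- (Quantifier elimination for $\mathbf{FO_{Bij}}$.) Let $\sigma$ be a unary functional signature and $\varphi(\bar t)$ a bijective first-order $\sigma$-formula with free variables $\bar t$. Then there exists a Boolean combination $\varphi'(\bar t)$ of bijective atomic formulas, with the same free variables $\bar t$, equivalent to $\varphi(\bar t)$, i.e. for every bijective $\sigma$-structure $\mathcal S$ and every tuple $\bar a$ of domain elements with $|\bar a|=|\bar t|$, $(\mathcal S,\bar a)\models\varphi(\bar t)$ iff $(\mathcal S,\bar a)\models\varphi'(\bar t)$. In the special case where $\varphi$ has no free variable, $\varphi$ is equivalent to a Boolean combination of cardinality statements.
   Context: A unary functional signature $\sigma=\{\bar c,\bar U,f_1,\dots,f_k\}$ consists of constant symbols, monadic predicate symbols and unary function symbols. A bijective $\sigma$-structure is a finite $\sigma$-structure in which every $f_i$ is interpreted as a permutation of the domain. A bijective term is $f_1^{\epsilon_1}\cdots f_l^{\epsilon_l}(x)$ with $l\ge0$, $x$ a variable, and each $f_i^{\epsilon_i}$ either a function symbol $f_i$ or its inverse $f_i^{ -1}$. A bijective atomic formula is one of: $\tau(x)=\tau_1(y)$; $\tau(x)=c$ with $c$ a constant symbol; $U(\tau(x))$ with $U$ monadic; or a cardinality statement $\exists^{\ge k}x\,\Psi(x)$ (meaning "there exist at least $k$ values of $x$ such that $\Psi(x)$"), where $\Psi$ is a Boolean combination of bijective atomic formulas in the single variable $x$; here $\tau,\tau_1$ are bijective terms. Bijective first-order formulas ($\mathbf{FO_{Bij}}$) are the first-order formulas built from bijective atomic formulas using Boolean connectives and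 quantifiers. -}

module Defs where

open import Data.Nat using (ℕ; zero; suc; _+_; _≤ᵇ_)
open import Data.Fin using (Fin; zero; suc; _≟_)
open import Data.Fin.Permutation using (Permutation′; _⟨$⟩ʳ_; _⟨$⟩ˡ_)
open import Data.Bool using (Bool; true; false; not; _∧_; _∨_; if_then_else_)
open import Data.List using (List; []; _∷_)
open import Data.Product using (_×_; _,_)
open import Data.Unit using (⊤)
open import Data.Empty using (⊥)
open import Relation.Nullary.Decidable using (⌊_⌋)

-- A unary functional signature: nc constant symbols, nu monadic predicate
-- symbols, nf unary function symbols.
record Signature : Set where
  field
    nc nu nf : ℕ

module _ (σ : Signature) where
  open Signature σ

  record Structure : Set where
    field
      size  : ℕ
      const : Fin nc → Fin (suc size)
      pred  : Fin nu → Fin (suc size) → Bool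
      fun   : Fin nf → Permutation′ (suc size)

  Dom : Structure → Set
  Dom S = Fin (suc (Structure.size S))

  data Dir : Set where
    fwd inv : Dir

  -- Bijective term f₁^ε₁ ⋯ f_l^ε_l (x), x a variable among n (de Bruijn).
  -- The list is [ (f₁,ε₁) , … , (f_l,ε_l) ]; the rightmost symbol is applied first.
  record BTerm (n : ℕ) : Set where
    constructor term
    field
      symbols : List (Fin nf × Dir)
      var     : Fin n

  mutual
    data Atom (n : ℕ) : Set where
      eqT  : BTerm n → BTerm n → Atom n
      eqC  : BTerm n → Fin nc → Atom n
      prd  : Fin nu → BTerm n → Atom n
      card : ℕ → BC 1 → Atom n                   -- ∃^{≥k} x Ψ(x), Ψ in the single variable x

    data BC (n : ℕ) : Set where
      atom : Atom n → BC n
      neg  : BC n → BC n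
      and  : BC n → BC n → BC n
      or   : BC n → BC n → BC n

  -- Bijective first-order formulas (variable 0 is bound by quantifiers).
  data Formula (n : ℕ) : Set where
    atom : Atom n → Formula n
    neg  : Formula n → Formula n
    and  : Formula n → Formula n → Formula n
    or   : Formula n → Formula n → Formula n
    ex   : Formula (suc n) → Formula n
    all  : Formula (suc n) → Formula n

  OnlyCard : ∀ {n} → BC n → Set
  OnlyCard (atom (eqT _ _)) = ⊥
  OnlyCard (atom (eqC _ _)) = ⊥
  OnlyCard (atom (prd _ _)) = ⊥
  OnlyCard (atom (card _ _)) = ⊤
  OnlyCard (neg φ) = OnlyCard φ
  OnlyCard (and φ ψ) = OnlyCard φ × OnlyCard ψ
  OnlyCard (or φ ψ) = OnlyCard φ × OnlyCard ψ

countF : ∀ {k} → (Fin k → Bool) → ℕ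
countF {zero} p = 0
countF {suc k} p = (if p zero then 1 else 0) + countF (λ i → p (suc i))

anyF : ∀ {k} → (Fin k → Bool) → Bool
anyF {zero} p = false
anyF {suc k} p = p zero ∨ anyF (λ i → p (suc i))

allF : ∀ {k} → (Fin k → Bool) → Bool
allF {zero} p = true
allF {suc k} p = p zero ∧ allF (λ i → p (suc i))

_▹_ : ∀ {A : Set} {n} → A → (Fin n → A) → Fin (suc n) → A
(a ▹ ρ) zero = a
(a ▹ ρ) (suc i) = ρ i

module Semantics (σ : Signature) (S : Structure σ) where
  open Signature σ
  open Structure S

  D : Set
  D = Fin (suc size)

  applyDir : Fin nf → Dir σ → D → D
  applyDir f fwd d = fun f ⟨$⟩ʳ d
  applyDir f inv d = fun f ⟨$⟩ˡ d

  applySyms : List (Fin nf × Dir σ) → D → D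
  applySyms [] d = d
  applySyms ((f , e) ∷ fs) d = applyDir f e (applySyms fs d)

  evalT : ∀ {n} → (Fin n → D) → BTerm σ n → D
  evalT ρ (term fs x) = applySyms fs (ρ x)

  mutual
    evalA : ∀ {n} → (Fin n → D) → Atom σ n → Bool
    evalA ρ (eqT t u) = ⌊ evalT ρ t ≟ evalT ρ u ⌋
    evalA ρ (eqC t c) = ⌊ evalT ρ t ≟ const c ⌋
    evalA ρ (prd U t) = pred U (evalT ρ t)
    evalA ρ (card k ψ) = k ≤ᵇ countF (λ x → evalBC (λ _ → x) ψ)

    evalBC : ∀ {n} → (Fin n → D) → BC σ n → Bool
    evalBC ρ (atom a) = evalA ρ a
    evalBC ρ (neg φ) = not (evalBC ρ φ)
    evalBC ρ (and φ ψ) = evalBC ρ φ ∧ evalBC ρ ψ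
    evalBC ρ (or φ ψ) = evalBC ρ φ ∨ evalBC ρ ψ

  evalF : ∀ {n} → (Fin n → D) → Formula σ n → Bool
  evalF ρ (atom a) = evalA ρ a
  evalF ρ (neg φ) = not (evalF ρ φ)
  evalF ρ (and φ ψ) = evalF ρ φ ∧ evalF ρ ψ
  evalF ρ (or φ ψ) = evalF ρ φ ∨ evalF ρ ψ
  evalF ρ (ex φ) = anyF (λ d → evalF (d ▹ ρ) φ)
  evalF ρ (all φ) = allF (λ d → evalF (d ▹ ρ) φ)

-- (S, ā) ⊨ φ   and   (S, ā) ⊨ φ'  (Boolean-valued, the domain being finite)
⟦_⟧F : ∀ {σ n} → Formula σ n → (S : Structure σ) → (Fin n → Dom σ S) → Bool
⟦ φ ⟧F S ρ = Semantics.evalF _ S ρ φ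

⟦_⟧BC : ∀ {σ n} → BC σ n → (S : Structure σ) → (Fin n → Dom σ S) → Bool
⟦ φ ⟧BC S ρ = Semantics.evalBC _ S ρ φ

-- An equation τ(x) = τ₁(y) between terms in different variables holds exactly
-- when x = τ⁻¹τ₁(y), since every term denotes a permutation.  So to eliminate
-- ∃x from a Boolean combination ψ(x, ȳ), collect the finitely many terms s(ȳ)
-- solving such equations, and split ∃x ψ into "ψ(s(ȳ)) for one of them" or
-- "ψ(x) for some x differing from all of them".  For such an x every mixed
-- equation is false, so ψ(x, ȳ) becomes a case distinction on conditions in ȳ
-- whose leaves χ(x) mention x alone.  Finally, "some x outside {s₁(ȳ), …, s_m(ȳ)}
-- satisfies χ" says that χ has more witnesses than those sᵢ(ȳ) that are
-- pairwise distinct and satisfy χ, which a case analysis over the sᵢ turns into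
-- cardinality statements ∃^{≥k} x χ(x).
module Submission where

open import Defs
open import Algebra.Bundles using (CommutativeMonoid)
open import Data.Nat using (ℕ; zero; suc; _+_; _≤ᵇ_)
open import Data.Nat.Properties using (+-commutativeSemigroup)
open import Data.Fin using (Fin; zero; suc; _≟_)
open import Data.Fin.Permutation using (inverseˡ; inverseʳ)
open import Data.Bool using (Bool; true; false; not; _∧_; _∨_; if_then_else_)
open import Data.Bool.Properties using (∨-identityʳ; ∧-assoc; if-float; ∨-commutativeMonoid)
open import Data.List using (List; []; _∷_; _++_)
open import Data.List.Membership.Propositional using (_∈_)
open import Data.List.Membership.Propositional.Properties using (∈-++⁺ˡ; ∈-++⁺ʳ)
open import Data.List.Relation.Unary.Any using (here; there)
open import Data.Product using (Σ; _×_; _,_)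
open import Data.Sum using (_⊎_; inj₁; inj₂; [_,_]′)
open import Data.Unit using (tt)
open import Function using (_∘_; id)
open import Relation.Nullary using (yes; no)
open import Relation.Nullary.Decidable using (⌊_⌋; ⌊⌋-map′; dec-no)
open import Relation.Binary.PropositionalEquality
  using (_≡_; _≢_; refl; sym; trans; cong; cong₂; module ≡-Reasoning)
open import Algebra.Properties.CommutativeSemigroup +-commutativeSemigroup
  using () renaming (x∙yz≈y∙xz to +-swapˡ)
open import Algebra.Properties.CommutativeSemigroup
  (CommutativeMonoid.commutativeSemigroup ∨-commutativeMonoid)
  using () renaming (x∙yz≈y∙xz to ∨-swapˡ)

open ≡-Reasoning

anyF-cong : ∀ {k} {p q : Fin k → Bool} → (∀ i → p i ≡ q i) → anyF p ≡ anyF q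
anyF-cong {zero}  p≗q = refl
anyF-cong {suc k} p≗q = cong₂ _∨_ (p≗q zero) (anyF-cong (p≗q ∘ suc))

allF-cong : ∀ {k} {p q : Fin k → Bool} → (∀ i → p i ≡ q i) → allF p ≡ allF q
allF-cong {zero}  p≗q = refl
allF-cong {suc k} p≗q = cong₂ _∧_ (p≗q zero) (allF-cong (p≗q ∘ suc))

countF-cong : ∀ {k} {p q : Fin k → Bool} → (∀ i → p i ≡ q i) → countF p ≡ countF q
countF-cong {zero}  p≗q = refl
countF-cong {suc k} p≗q =
  cong₂ (λ b c → (if b then 1 else 0) + c) (p≗q zero) (countF-cong (p≗q ∘ suc))

allF≡not-anyF-not : ∀ {k} (p : Fin k → Bool) → allF p ≡ not (anyF (not ∘ p))
allF≡not-anyF-not {zero}  p = refl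
allF≡not-anyF-not {suc k} p with p zero
... | true  = allF≡not-anyF-not (p ∘ suc)
... | false = refl

anyF≡1≤ᵇcountF : ∀ {k} (p : Fin k → Bool) → anyF p ≡ (1 ≤ᵇ countF p)
anyF≡1≤ᵇcountF {zero}  p = refl
anyF≡1≤ᵇcountF {suc k} p with p zero
... | true  = refl
... | false = anyF≡1≤ᵇcountF (p ∘ suc)

anyF-if : ∀ {k} b (r p q : Fin k → Bool) →
          ((b ∧ anyF (λ x → r x ∧ p x)) ∨ (not b ∧ anyF (λ x → r x ∧ q x)))
          ≡ anyF (λ x → r x ∧ (if b then p x else q x))
anyF-if true  r p q = ∨-identityʳ _
anyF-if false r p q = refl

indicator : Bool → ℕ
indicator b = if b then 1 else 0

_∖_ : ∀ {k} → (Fin k → Bool) → Fin k → Fin k → Bool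
(p ∖ a) x = not ⌊ x ≟ a ⌋ ∧ p x

∖-suc : ∀ {k} (p : Fin (suc k) → Bool) a i → (p ∖ suc a) (suc i) ≡ ((p ∘ suc) ∖ a) i
∖-suc p a i = cong (λ b → not b ∧ p (suc i)) (⌊⌋-map′ _ _ (i ≟ a))

anyF-split : ∀ {k} (p : Fin k → Bool) a → anyF p ≡ p a ∨ anyF (p ∖ a)
anyF-split p zero    = refl
anyF-split p (suc a) = begin
  p zero ∨ anyF (p ∘ suc)
    ≡⟨ cong (p zero ∨_) (anyF-split (p ∘ suc) a) ⟩
  p zero ∨ (p (suc a) ∨ anyF ((p ∘ suc) ∖ a))
    ≡⟨ ∨-swapˡ (p zero) (p (suc a)) (anyF ((p ∘ suc) ∖ a)) ⟩
  p (suc a) ∨ (p zero ∨ anyF ((p ∘ suc) ∖ a))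
    ≡⟨ cong (λ r → p (suc a) ∨ (p zero ∨ r)) (sym (anyF-cong (∖-suc p a))) ⟩
  p (suc a) ∨ anyF (p ∖ suc a) ∎

countF-split : ∀ {k} (p : Fin k → Bool) a → countF p ≡ indicator (p a) + countF (p ∖ a)
countF-split p zero    = refl
countF-split p (suc a) = begin
  indicator (p zero) + countF (p ∘ suc)
    ≡⟨ cong (indicator (p zero) +_) (countF-split (p ∘ suc) a) ⟩
  indicator (p zero) + (indicator (p (suc a)) + countF ((p ∘ suc) ∖ a))
    ≡⟨ +-swapˡ (indicator (p zero)) (indicator (p (suc a))) (countF ((p ∘ suc) ∖ a)) ⟩
  indicator (p (suc a)) + (indicator (p zero) + countF ((p ∘ suc) ∖ a))
    ≡⟨ cong (λ r → indicator (p (suc a)) + (indicator (p zero) + r)) (sym (countF-cong (∖-suc p a))) ⟩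
  indicator (p (suc a)) + countF (p ∖ suc a) ∎

≤ᵇ-indicator-step : ∀ k b c →
  ((b ∧ (suc k ≤ᵇ indicator b + c)) ∨ (not b ∧ (k ≤ᵇ indicator b + c))) ≡ (k ≤ᵇ c)
≤ᵇ-indicator-step zero    true  c = refl
≤ᵇ-indicator-step (suc k) true  c = ∨-identityʳ _
≤ᵇ-indicator-step k       false c = refl

if-true-false : ∀ b → (if b then true else false) ≡ b
if-true-false true  = refl
if-true-false false = refl

guarded-∧-cong : ∀ b {p q : Bool} → (b ≡ true → p ≡ q) → (b ∧ p) ≡ (b ∧ q)
guarded-∧-cong true  p≡q = p≡q refl
guarded-∧-cong false p≡q = refl

module Elimination (σ : Signature) where
  open Signature σ

  Sym : Set
  Sym = Fin nf × Dir σ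

  flipDir : Dir σ → Dir σ
  flipDir fwd = inv
  flipDir inv = fwd

  inverseWord : List Sym → List Sym
  inverseWord []             = []
  inverseWord ((f , e) ∷ fs) = inverseWord fs ++ (f , flipDir e) ∷ []

  ⊤BC ⊥BC : ∀ {n} → BC σ n
  ⊤BC = atom (card 0 (atom (eqT (term [] zero) (term [] zero))))
  ⊥BC = neg ⊤BC

  Subst : ℕ → ℕ → Set
  Subst m n = Fin m → BTerm σ n

  idSubst : ∀ {n} → Subst n n
  idSubst = term []

  substT : ∀ {m n} → Subst m n → BTerm σ m → BTerm σ n
  substT θ (term fs i) = term (fs ++ BTerm.symbols (θ i)) (BTerm.var (θ i))

  substA : ∀ {m n} → Subst m n → Atom σ m → Atom σ n
  substA θ (eqT t u)  = eqT (substT θ t) (substT θ u)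
  substA θ (eqC t c)  = eqC (substT θ t) c
  substA θ (prd U t)  = prd U (substT θ t)
  substA θ (card k ψ) = card k ψ

  substBC : ∀ {m n} → Subst m n → BC σ m → BC σ n
  substBC θ (atom a)  = atom (substA θ a)
  substBC θ (neg φ)   = neg (substBC θ φ)
  substBC θ (and φ ψ) = and (substBC θ φ) (substBC θ ψ)
  substBC θ (or φ ψ)  = or (substBC θ φ) (substBC θ ψ)

  data CaseTree (n : ℕ) : Set where
    leaf   : BC σ 1 → CaseTree n
    branch : BC σ n → CaseTree n → CaseTree n → CaseTree n

  mapLeaves : ∀ {n} → (BC σ 1 → BC σ 1) → CaseTree n → CaseTree n
  mapLeaves f (leaf χ)       = leaf (f χ)
  mapLeaves f (branch c l r) = branch c (mapLeaves f l) (mapLeaves f r)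

  zipLeaves : ∀ {n} → (BC σ 1 → BC σ 1 → BC σ 1) → CaseTree n → CaseTree n → CaseTree n
  zipLeaves op (leaf χ)       t = mapLeaves (op χ) t
  zipLeaves op (branch c l r) t = branch c (zipLeaves op l t) (zipLeaves op r t)

  caseOn : ∀ {n} → Atom σ n → CaseTree n
  caseOn a = branch (atom a) (leaf ⊤BC) (leaf ⊥BC)

  solutionsAtom : ∀ {n} → Atom σ (suc n) → List (BTerm σ n)
  solutionsAtom (eqT (term fs zero) (term gs (suc j))) = term (inverseWord fs ++ gs) j ∷ []
  solutionsAtom (eqT (term fs (suc i)) (term gs zero)) = term (inverseWord gs ++ fs) i ∷ []
  solutionsAtom _                                      = []

  solutions : ∀ {n} → BC σ (suc n) → List (BTerm σ n)
  solutions (atom a)  = solutionsAtom a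
  solutions (neg φ)   = solutions φ
  solutions (and φ ψ) = solutions φ ++ solutions ψ
  solutions (or φ ψ)  = solutions φ ++ solutions ψ

  separateAtom : ∀ {n} → Atom σ (suc n) → CaseTree n
  separateAtom (eqT (term fs zero) (term gs zero))       = leaf (atom (eqT (term fs zero) (term gs zero)))
  separateAtom (eqT (term fs zero) (term gs (suc j)))    = leaf ⊥BC
  separateAtom (eqT (term fs (suc i)) (term gs zero))    = leaf ⊥BC
  separateAtom (eqT (term fs (suc i)) (term gs (suc j))) = caseOn (eqT (term fs i) (term gs j))
  separateAtom (eqC (term fs zero) c)                    = leaf (atom (eqC (term fs zero) c))
  separateAtom (eqC (term fs (suc i)) c)                 = caseOn (eqC (term fs i) c)
  separateAtom (prd U (term fs zero))                    = leaf (atom (prd U (term fs zero)))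
  separateAtom (prd U (term fs (suc i)))                 = caseOn (prd U (term fs i))
  separateAtom (card k ψ)                                = leaf (atom (card k ψ))

  separate : ∀ {n} → BC σ (suc n) → CaseTree n
  separate (atom a)  = separateAtom a
  separate (neg φ)   = mapLeaves neg (separate φ)
  separate (and φ ψ) = zipLeaves and (separate φ) (separate ψ)
  separate (or φ ψ)  = zipLeaves or (separate φ) (separate ψ)

  distinctFrom : ∀ {n} → List (BTerm σ n) → BTerm σ n → BC σ n
  distinctFrom []       s = ⊤BC
  distinctFrom (t ∷ ts) s = and (neg (atom (eqT s t))) (distinctFrom ts s)

  -- Removing s from the excluded terms adds a witness of χ exactly when s(ȳ)
  -- is new, i.e. distinct from the remaining ones, and satisfies χ.
  atLeastOutside : ∀ {n} → BC σ 1 → List (BTerm σ n) → ℕ → BC σ n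
  atLeastOutside χ []       k = atom (card k χ)
  atLeastOutside χ (s ∷ ts) k =
    or (and new (atLeastOutside χ ts (suc k))) (and (neg new) (atLeastOutside χ ts k))
    where new = and (distinctFrom ts s) (substBC (λ _ → s) χ)

  ∃outsideTree : ∀ {n} → List (BTerm σ n) → CaseTree n → BC σ n
  ∃outsideTree ts (leaf χ)       = atLeastOutside χ ts 1
  ∃outsideTree ts (branch c l r) =
    or (and c (∃outsideTree ts l)) (and (neg c) (∃outsideTree ts r))

  ∃outside : ∀ {n} → BC σ (suc n) → List (BTerm σ n) → List (BTerm σ n) → BC σ n
  ∃outside ψ ts []       = ∃outsideTree ts (separate ψ)
  ∃outside ψ ts (s ∷ us) =
    or (and (distinctFrom ts s) (substBC (s ▹ idSubst) ψ)) (∃outside ψ (s ∷ ts) us)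

  eliminate∃ : ∀ {n} → BC σ (suc n) → BC σ n
  eliminate∃ ψ = ∃outside ψ [] (solutions ψ)

  qe : ∀ {n} → Formula σ n → BC σ n
  qe (atom a)  = atom a
  qe (neg φ)   = neg (qe φ)
  qe (and φ ψ) = and (qe φ) (qe ψ)
  qe (or φ ψ)  = or (qe φ) (qe ψ)
  qe (ex φ)    = eliminate∃ (qe φ)
  qe (all φ)   = neg (eliminate∃ (neg (qe φ)))

  closed⇒OnlyCard : (ψ : BC σ 0) → OnlyCard σ ψ
  closed⇒OnlyCard (atom (eqT (term _ ()) _))
  closed⇒OnlyCard (atom (eqC (term _ ()) _))
  closed⇒OnlyCard (atom (prd _ (term _ ())))
  closed⇒OnlyCard (atom (card _ _)) = tt
  closed⇒OnlyCard (neg ψ)           = closed⇒OnlyCard ψ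
  closed⇒OnlyCard (and ψ χ)         = closed⇒OnlyCard ψ , closed⇒OnlyCard χ
  closed⇒OnlyCard (or ψ χ)          = closed⇒OnlyCard ψ , closed⇒OnlyCard χ

module Correctness (σ : Signature) (S : Structure σ) where
  open Structure S
  open Semantics σ S
  open Elimination σ

  applySyms-++ : ∀ fs gs d → applySyms (fs ++ gs) d ≡ applySyms fs (applySyms gs d)
  applySyms-++ []             gs d = refl
  applySyms-++ ((f , e) ∷ fs) gs d = cong (applyDir f e) (applySyms-++ fs gs d)

  applyDir-flipDir : ∀ f e d → applyDir f (flipDir e) (applyDir f e d) ≡ d
  applyDir-flipDir f fwd d = inverseˡ (fun f)
  applyDir-flipDir f inv d = inverseʳ (fun f)

  applySyms-inverseWord : ∀ fs d → applySyms (inverseWord fs) (applySyms fs d) ≡ d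
  applySyms-inverseWord []             d = refl
  applySyms-inverseWord ((f , e) ∷ fs) d = begin
    applySyms (inverseWord fs ++ (f , flipDir e) ∷ []) (applyDir f e (applySyms fs d))
      ≡⟨ applySyms-++ (inverseWord fs) _ _ ⟩
    applySyms (inverseWord fs) (applyDir f (flipDir e) (applyDir f e (applySyms fs d)))
      ≡⟨ cong (applySyms (inverseWord fs)) (applyDir-flipDir f e _) ⟩
    applySyms (inverseWord fs) (applySyms fs d)
      ≡⟨ applySyms-inverseWord fs d ⟩
    d ∎

  applySyms-solve : ∀ fs gs {x} d → applySyms fs x ≡ applySyms gs d →
                    x ≡ applySyms (inverseWord fs ++ gs) d
  applySyms-solve fs gs {x} d eq = begin
    x                                             ≡⟨ sym (applySyms-inverseWord fs x) ⟩
    applySyms (inverseWord fs) (applySyms fs x)   ≡⟨ cong (applySyms (inverseWord fs)) eq ⟩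
    applySyms (inverseWord fs) (applySyms gs d)   ≡⟨ sym (applySyms-++ (inverseWord fs) gs d) ⟩
    applySyms (inverseWord fs ++ gs) d            ∎

  evalBC-cong : ∀ {n} {ρ ρ′ : Fin n → D} → (∀ i → ρ i ≡ ρ′ i) → ∀ ψ → evalBC ρ ψ ≡ evalBC ρ′ ψ
  evalBC-cong ρ≗ρ′ (atom (eqT (term fs i) (term gs j))) =
    cong₂ (λ a b → ⌊ applySyms fs a ≟ applySyms gs b ⌋) (ρ≗ρ′ i) (ρ≗ρ′ j)
  evalBC-cong ρ≗ρ′ (atom (eqC (term fs i) c)) = cong (λ a → ⌊ applySyms fs a ≟ const c ⌋) (ρ≗ρ′ i)
  evalBC-cong ρ≗ρ′ (atom (prd U (term fs i))) = cong (pred U ∘ applySyms fs) (ρ≗ρ′ i)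
  evalBC-cong ρ≗ρ′ (atom (card k ψ))          = refl
  evalBC-cong ρ≗ρ′ (neg ψ)                    = cong not (evalBC-cong ρ≗ρ′ ψ)
  evalBC-cong ρ≗ρ′ (and ψ χ)                  = cong₂ _∧_ (evalBC-cong ρ≗ρ′ ψ) (evalBC-cong ρ≗ρ′ χ)
  evalBC-cong ρ≗ρ′ (or ψ χ)                   = cong₂ _∨_ (evalBC-cong ρ≗ρ′ ψ) (evalBC-cong ρ≗ρ′ χ)

  evalT-subst : ∀ {m n} (ρ : Fin n → D) (θ : Subst m n) t →
                evalT ρ (substT θ t) ≡ evalT (evalT ρ ∘ θ) t
  evalT-subst ρ θ (term fs i) = applySyms-++ fs _ _

  evalBC-subst : ∀ {m n} (ρ : Fin n → D) (θ : Subst m n) ψ →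
                 evalBC ρ (substBC θ ψ) ≡ evalBC (evalT ρ ∘ θ) ψ
  evalBC-subst ρ θ (atom (eqT t u))  = cong₂ (λ a b → ⌊ a ≟ b ⌋) (evalT-subst ρ θ t) (evalT-subst ρ θ u)
  evalBC-subst ρ θ (atom (eqC t c))  = cong (λ a → ⌊ a ≟ const c ⌋) (evalT-subst ρ θ t)
  evalBC-subst ρ θ (atom (prd U t))  = cong (pred U) (evalT-subst ρ θ t)
  evalBC-subst ρ θ (atom (card k ψ)) = refl
  evalBC-subst ρ θ (neg ψ)           = cong not (evalBC-subst ρ θ ψ)
  evalBC-subst ρ θ (and ψ χ)         = cong₂ _∧_ (evalBC-subst ρ θ ψ) (evalBC-subst ρ θ χ)
  evalBC-subst ρ θ (or ψ χ)          = cong₂ _∨_ (evalBC-subst ρ θ ψ) (evalBC-subst ρ θ χ)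

  evalBC-instantiate : ∀ {n} (ρ : Fin n → D) s ψ →
                       evalBC ρ (substBC (s ▹ idSubst) ψ) ≡ evalBC (evalT ρ s ▹ ρ) ψ
  evalBC-instantiate ρ s ψ = trans (evalBC-subst ρ (s ▹ idSubst) ψ) (evalBC-cong pointwise ψ)
    where
    pointwise : ∀ i → evalT ρ ((s ▹ idSubst) i) ≡ (evalT ρ s ▹ ρ) i
    pointwise zero    = refl
    pointwise (suc i) = refl

  ⟦_⟧₁ : BC σ 1 → D → Bool
  ⟦ χ ⟧₁ x = evalBC (λ _ → x) χ

  evalTree : ∀ {n} → (Fin n → D) → D → CaseTree n → Bool
  evalTree ρ x (leaf χ)       = ⟦ χ ⟧₁ x
  evalTree ρ x (branch c l r) = if evalBC ρ c then evalTree ρ x l else evalTree ρ x r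

  evalTree-mapLeaves : ∀ {n} (ρ : Fin n → D) x (f : BC σ 1 → BC σ 1) (g : Bool → Bool) →
                       (∀ χ → ⟦ f χ ⟧₁ x ≡ g (⟦ χ ⟧₁ x)) →
                       ∀ t → evalTree ρ x (mapLeaves f t) ≡ g (evalTree ρ x t)
  evalTree-mapLeaves ρ x f g f≈g (leaf χ)       = f≈g χ
  evalTree-mapLeaves ρ x f g f≈g (branch c l r) =
    trans (cong₂ (if_then_else_ (evalBC ρ c)) (evalTree-mapLeaves ρ x f g f≈g l)
                                               (evalTree-mapLeaves ρ x f g f≈g r))
          (sym (if-float g (evalBC ρ c)))

  evalTree-zipLeaves : ∀ {n} (ρ : Fin n → D) x
                       (op : BC σ 1 → BC σ 1 → BC σ 1) (_⊕_ : Bool → Bool → Bool) →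
                       (∀ χ ψ → ⟦ op χ ψ ⟧₁ x ≡ ⟦ χ ⟧₁ x ⊕ ⟦ ψ ⟧₁ x) →
                       ∀ t u → evalTree ρ x (zipLeaves op t u) ≡ evalTree ρ x t ⊕ evalTree ρ x u
  evalTree-zipLeaves ρ x op _⊕_ op≈⊕ (leaf χ) u =
    evalTree-mapLeaves ρ x (op χ) (⟦ χ ⟧₁ x ⊕_) (op≈⊕ χ) u
  evalTree-zipLeaves ρ x op _⊕_ op≈⊕ (branch c l r) u =
    trans (cong₂ (if_then_else_ (evalBC ρ c)) (evalTree-zipLeaves ρ x op _⊕_ op≈⊕ l u)
                                               (evalTree-zipLeaves ρ x op _⊕_ op≈⊕ r u))
          (sym (if-float (_⊕ evalTree ρ x u) (evalBC ρ c)))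

  ⌊≟⌋-false : ∀ {a b : D} → a ≢ b → ⌊ a ≟ b ⌋ ≡ false
  ⌊≟⌋-false {a} {b} a≢b = cong ⌊_⌋ (dec-no (a ≟ b) a≢b)

  Avoids : ∀ {n} → (Fin n → D) → D → List (BTerm σ n) → Set
  Avoids ρ x ts = ∀ s → s ∈ ts → x ≢ evalT ρ s

  evalA-separateAtom : ∀ {n} (ρ : Fin n → D) x a → Avoids ρ x (solutionsAtom a) →
                        evalA (x ▹ ρ) a ≡ evalTree ρ x (separateAtom a)
  evalA-separateAtom ρ x (eqT (term fs zero) (term gs zero)) avoids = refl
  evalA-separateAtom ρ x (eqT (term fs zero) (term gs (suc j))) avoids =
    ⌊≟⌋-false (avoids _ (here refl) ∘ applySyms-solve fs gs (ρ j))
  evalA-separateAtom ρ x (eqT (term fs (suc i)) (term gs zero)) avoids =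
    ⌊≟⌋-false (avoids _ (here refl) ∘ applySyms-solve gs fs (ρ i) ∘ sym)
  evalA-separateAtom ρ x (eqT (term fs (suc i)) (term gs (suc j))) avoids = sym (if-true-false _)
  evalA-separateAtom ρ x (eqC (term fs zero) c) avoids = refl
  evalA-separateAtom ρ x (eqC (term fs (suc i)) c) avoids = sym (if-true-false _)
  evalA-separateAtom ρ x (prd U (term fs zero)) avoids = refl
  evalA-separateAtom ρ x (prd U (term fs (suc i))) avoids = sym (if-true-false _)
  evalA-separateAtom ρ x (card k ψ) avoids = refl

  evalBC-separate : ∀ {n} (ρ : Fin n → D) x ψ → Avoids ρ x (solutions ψ) →
                    evalBC (x ▹ ρ) ψ ≡ evalTree ρ x (separate ψ)
  evalBC-separate ρ x (atom a) avoids = evalA-separateAtom ρ x a avoids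
  evalBC-separate ρ x (neg ψ) avoids =
    trans (cong not (evalBC-separate ρ x ψ avoids))
          (sym (evalTree-mapLeaves ρ x neg not (λ _ → refl) (separate ψ)))
  evalBC-separate ρ x (and ψ χ) avoids =
    trans (cong₂ _∧_ (evalBC-separate ρ x ψ (λ s → avoids s ∘ ∈-++⁺ˡ))
                     (evalBC-separate ρ x χ (λ s → avoids s ∘ ∈-++⁺ʳ (solutions ψ))))
          (sym (evalTree-zipLeaves ρ x and _∧_ (λ _ _ → refl) (separate ψ) (separate χ)))
  evalBC-separate ρ x (or ψ χ) avoids =
    trans (cong₂ _∨_ (evalBC-separate ρ x ψ (λ s → avoids s ∘ ∈-++⁺ˡ))
                     (evalBC-separate ρ x χ (λ s → avoids s ∘ ∈-++⁺ʳ (solutions ψ))))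
          (sym (evalTree-zipLeaves ρ x or _∨_ (λ _ _ → refl) (separate ψ) (separate χ)))

  outside : ∀ {n} → (Fin n → D) → List (BTerm σ n) → D → Bool
  outside ρ []       = λ _ → true
  outside ρ (t ∷ ts) = outside ρ ts ∖ evalT ρ t

  evalBC-distinctFrom : ∀ {n} (ρ : Fin n → D) ts s →
                        evalBC ρ (distinctFrom ts s) ≡ outside ρ ts (evalT ρ s)
  evalBC-distinctFrom ρ []       s = refl
  evalBC-distinctFrom ρ (t ∷ ts) s = cong (not ⌊ evalT ρ s ≟ evalT ρ t ⌋ ∧_) (evalBC-distinctFrom ρ ts s)

  outside⇒Avoids : ∀ {n} (ρ : Fin n → D) ts x → outside ρ ts x ≡ true → Avoids ρ x ts
  outside⇒Avoids ρ (t ∷ ts) x out s (here refl) x≡s with x ≟ evalT ρ t | out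
  ... | yes _  | ()
  ... | no x≢t | _    = x≢t x≡s
  outside⇒Avoids ρ (t ∷ ts) x out s (there s∈ts) x≡s with x ≟ evalT ρ t | out
  ... | yes _ | ()
  ... | no _  | out′ = outside⇒Avoids ρ ts x out′ s s∈ts x≡s

  evalBC-atLeastOutside : ∀ {n} (ρ : Fin n → D) χ ts k →
                          evalBC ρ (atLeastOutside χ ts k)
                          ≡ (k ≤ᵇ countF (λ x → outside ρ ts x ∧ ⟦ χ ⟧₁ x))
  evalBC-atLeastOutside ρ χ []       k = refl
  evalBC-atLeastOutside ρ χ (s ∷ ts) k = begin
    (evalBC ρ new ∧ evalBC ρ (atLeastOutside χ ts (suc k)))
      ∨ (not (evalBC ρ new) ∧ evalBC ρ (atLeastOutside χ ts k))
      ≡⟨ cong₂ (λ u v → (evalBC ρ new ∧ u) ∨ (not (evalBC ρ new) ∧ v))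
               (evalBC-atLeastOutside ρ χ ts (suc k)) (evalBC-atLeastOutside ρ χ ts k) ⟩
    (evalBC ρ new ∧ (suc k ≤ᵇ countF p)) ∨ (not (evalBC ρ new) ∧ (k ≤ᵇ countF p))
      ≡⟨ cong₂ (λ b c → (b ∧ (suc k ≤ᵇ c)) ∨ (not b ∧ (k ≤ᵇ c))) new≡pa (countF-split p a) ⟩
    (p a ∧ (suc k ≤ᵇ indicator (p a) + countF (p ∖ a)))
      ∨ (not (p a) ∧ (k ≤ᵇ indicator (p a) + countF (p ∖ a)))
      ≡⟨ ≤ᵇ-indicator-step k (p a) _ ⟩
    k ≤ᵇ countF (p ∖ a)
      ≡⟨ cong (k ≤ᵇ_) (countF-cong (λ x → sym (∧-assoc (not ⌊ x ≟ a ⌋) (outside ρ ts x) (⟦ χ ⟧₁ x)))) ⟩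
    k ≤ᵇ countF (λ x → outside ρ (s ∷ ts) x ∧ ⟦ χ ⟧₁ x) ∎
    where
    a = evalT ρ s
    new = and (distinctFrom ts s) (substBC (λ _ → s) χ)
    p : D → Bool
    p x = outside ρ ts x ∧ ⟦ χ ⟧₁ x
    new≡pa : evalBC ρ new ≡ p a
    new≡pa = cong₂ _∧_ (evalBC-distinctFrom ρ ts s) (evalBC-subst ρ (λ _ → s) χ)

  evalBC-∃outsideTree : ∀ {n} (ρ : Fin n → D) ts t →
                        evalBC ρ (∃outsideTree ts t) ≡ anyF (λ x → outside ρ ts x ∧ evalTree ρ x t)
  evalBC-∃outsideTree ρ ts (leaf χ) =
    trans (evalBC-atLeastOutside ρ χ ts 1) (sym (anyF≡1≤ᵇcountF (λ x → outside ρ ts x ∧ ⟦ χ ⟧₁ x)))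
  evalBC-∃outsideTree ρ ts (branch c l r) =
    trans (cong₂ (λ u v → (evalBC ρ c ∧ u) ∨ (not (evalBC ρ c) ∧ v))
                 (evalBC-∃outsideTree ρ ts l) (evalBC-∃outsideTree ρ ts r))
          (anyF-if (evalBC ρ c) (outside ρ ts) (λ x → evalTree ρ x l) (λ x → evalTree ρ x r))

  evalBC-∃outside : ∀ {n} (ρ : Fin n → D) ψ ts us →
                    (∀ t → t ∈ solutions ψ → t ∈ ts ⊎ t ∈ us) →
                    evalBC ρ (∃outside ψ ts us) ≡ anyF (λ x → outside ρ ts x ∧ evalBC (x ▹ ρ) ψ)
  evalBC-∃outside ρ ψ ts [] covered =
    trans (evalBC-∃outsideTree ρ ts (separate ψ))
          (anyF-cong (λ x → guarded-∧-cong (outside ρ ts x) (λ out →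
             sym (evalBC-separate ρ x ψ (λ s → outside⇒Avoids ρ ts x out s ∘ [ id , (λ ()) ]′ ∘ covered s)))))
  evalBC-∃outside ρ ψ ts (s ∷ us) covered = begin
    (evalBC ρ (distinctFrom ts s) ∧ evalBC ρ (substBC (s ▹ idSubst) ψ)) ∨ evalBC ρ (∃outside ψ (s ∷ ts) us)
      ≡⟨ cong₂ _∨_ (cong₂ _∧_ (evalBC-distinctFrom ρ ts s) (evalBC-instantiate ρ s ψ))
                   (evalBC-∃outside ρ ψ (s ∷ ts) us (λ t → shift ∘ covered t)) ⟩
    p a ∨ anyF (λ x → outside ρ (s ∷ ts) x ∧ evalBC (x ▹ ρ) ψ)
      ≡⟨ cong (p a ∨_) (anyF-cong (λ x → ∧-assoc (not ⌊ x ≟ a ⌋) (outside ρ ts x) (evalBC (x ▹ ρ) ψ))) ⟩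
    p a ∨ anyF (p ∖ a)
      ≡⟨ sym (anyF-split p a) ⟩
    anyF p ∎
    where
    a = evalT ρ s
    p : D → Bool
    p x = outside ρ ts x ∧ evalBC (x ▹ ρ) ψ
    shift : ∀ {t} → t ∈ ts ⊎ t ∈ s ∷ us → t ∈ s ∷ ts ⊎ t ∈ us
    shift (inj₁ t∈ts)         = inj₁ (there t∈ts)
    shift (inj₂ (here t≡s))   = inj₁ (here t≡s)
    shift (inj₂ (there t∈us)) = inj₂ t∈us

  evalBC-eliminate∃ : ∀ {n} (ρ : Fin n → D) ψ → evalBC ρ (eliminate∃ ψ) ≡ anyF (λ x → evalBC (x ▹ ρ) ψ)
  evalBC-eliminate∃ ρ ψ = evalBC-∃outside ρ ψ [] (solutions ψ) (λ _ → inj₂)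

  evalF≡evalBC-qe : ∀ {n} (ρ : Fin n → D) φ → evalF ρ φ ≡ evalBC ρ (qe φ)
  evalF≡evalBC-qe ρ (atom a)  = refl
  evalF≡evalBC-qe ρ (neg φ)   = cong not (evalF≡evalBC-qe ρ φ)
  evalF≡evalBC-qe ρ (and φ ψ) = cong₂ _∧_ (evalF≡evalBC-qe ρ φ) (evalF≡evalBC-qe ρ ψ)
  evalF≡evalBC-qe ρ (or φ ψ)  = cong₂ _∨_ (evalF≡evalBC-qe ρ φ) (evalF≡evalBC-qe ρ ψ)
  evalF≡evalBC-qe ρ (ex φ)    = begin
    anyF (λ x → evalF (x ▹ ρ) φ)           ≡⟨ anyF-cong (λ x → evalF≡evalBC-qe (x ▹ ρ) φ) ⟩
    anyF (λ x → evalBC (x ▹ ρ) (qe φ))     ≡⟨ sym (evalBC-eliminate∃ ρ (qe φ)) ⟩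
    evalBC ρ (eliminate∃ (qe φ))           ∎
  evalF≡evalBC-qe ρ (all φ)   = begin
    allF (λ x → evalF (x ▹ ρ) φ)                     ≡⟨ allF-cong (λ x → evalF≡evalBC-qe (x ▹ ρ) φ) ⟩
    allF (λ x → evalBC (x ▹ ρ) (qe φ))               ≡⟨ allF≡not-anyF-not (λ x → evalBC (x ▹ ρ) (qe φ)) ⟩
    not (anyF (λ x → evalBC (x ▹ ρ) (neg (qe φ))))   ≡⟨ cong not (sym (evalBC-eliminate∃ ρ (neg (qe φ)))) ⟩
    not (evalBC ρ (eliminate∃ (neg (qe φ))))         ∎

mainTheorem3 : (σ : Signature)
    → ((n : ℕ) (φ : Formula σ n) → Σ (BC σ n) λ φ' →
    (S : Structure σ) (a : Fin n → Dom σ S) → ⟦ φ ⟧F S a ≡ ⟦ φ' ⟧BC S a)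
    × ((φ : Formula σ 0) → Σ (BC σ 0) λ φ' → OnlyCard σ φ' ×
    ((S : Structure σ) (a : Fin 0 → Dom σ S) → ⟦ φ ⟧F S a ≡ ⟦ φ' ⟧BC S a))
mainTheorem3 σ =
  (λ n φ → qe φ , correct φ) ,
  (λ φ → qe φ , closed⇒OnlyCard (qe φ) , correct φ)
  where
  open Elimination σ
  correct : ∀ {n} (φ : Formula σ n) (S : Structure σ) (a : Fin n → Dom σ S) → ⟦ φ ⟧F S a ≡ ⟦ qe φ ⟧BC S a
  correct φ S a = Correctness.evalF≡evalBC-qe σ S a φ
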